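{- Let $\Delta\vdash B$ be a partial duplication of the LJ$^{+}$-sequent $\Sigma\vdash A$. If $u$ is a proof-term of $\Sigma\vdash A$ and $t\in\mathcal F_{\Sigma\vdash A}^{\Delta\vdash B}(u)$, then $t$ is a proof-term of $\Delta\vdash B$.
   Context: Formulas of minimal predicate logic are built from atomic formulas with $\to$ and $\forall$. LJ$^{+}$: a context with named formulae is a finite set of declarations $\alpha:C$ ($\alpha$ a proof variable, distinct from term variables), each proof variable declared at most once; sequents $\Delta\vdash B$. Typing rules: (L$\to$) if $\Delta$ contains $\alpha:A_1\to\dots\to A_n\to P$ with $P$ atomic and $\Delta\vdash t_i:A_i$ for all $i$, then $\Delta\vdash(\alpha\,t_1\dots t_n):P$; (R$\forall$) if $\Delta\vdash t:A$ and $x$ not free in $\Delta$ then $\Delta\vdash\lambda x\,t:\forall x\,A$; (R$\to$) if $\Delta,\alpha:A\vdash t:B$ then $\Delta\vdash\lambda\alpha\,t:A\to B$. $t$ is a proof-term of $\Delta\vdash B$ if $\Delta\vdash t:B$ is derivable. Partial duplication: $\Delta\vdash B$ is a partial duplication of $\Sigma\vdash A$ if there exist substitutions $\sigma_1,\sigma_2$ of term variables with the same domain, renaming the variables of the domain into fresh distinct variables, such that for each declaration $\gamma:C$ of $\Sigma$, $\Delta$ contains $\gamma_1:\sigma_1C$ or $\gamma_2:\sigma_2C$ or both (the $\gamma_1,\gamma_2$ being distinct fresh proof variables, the two copies of $\gamma$), and $B$ is $\sigma_1A$ or $\sigma_2A$. The set $\mathcal F_{\Sigma\vdash A}^{\Delta\vdash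 B}(u)$, for a proof-term $u$ of $\Sigma\vdash A$, is defined by induction on $u$: if $u=(\alpha\,u_1\dots u_n)$ with $\alpha:C_1\to\dots\to C_n\to A$ in $\Sigma$ ($A$ atomic), then for each $i\in\{1,2\}$: if $\Delta$ contains $\alpha_i:\sigma_iC_1\to\dots\to\sigma_iC_n\to\sigma_iA$ and $\sigma_iA=B$, the set contains all $(\alpha_i\,u'_1\dots u'_n)$ with $u'_j\in\mathcal F_{\Sigma\vdash C_j}^{\Delta\vdash\sigma_iC_j}(u_j)$, and otherwise no term with head $\alpha_i$; if $u=\lambda x\,u_1$, then $A=\forall x\,A_1$, $B=\forall x\,B_1$ with $B_1$ equal to $\sigma_1A_1$ or $\sigma_2A_1$, and the set consists of all $\lambda x\,u'_1$ with $u'_1\in\mathcal F_{\Sigma\vdash A_1}^{\Delta\vdash B_1}(u_1)$; if $u=\lambda\alpha\,u_1$, then $A=A_1\to A_2$, $B=B_1\to B_2$ with $B_k$ equal to $\sigma_1A_k$ or $\sigma_2A_k$, and the set consists of all $\lambda\alpha'\,u'_1$ with $u'_1\in\mathcal F_{\Sigma,\alpha:A_1\vdash A_2}^{\Delta,\alpha':B_1\vdash B_2}(u_1)$. -}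

module Defs where

open import Data.Nat using (ℕ; _≡ᵇ_)
open import Data.Bool using (if_then_else_)
open import Data.Fin using (Fin)
open import Data.List using (List; []; _∷_; map)
open import Data.Bool.ListAction using (any)
open import Data.List.Membership.Propositional using (_∈_; _∉_)
open import Data.Product using (_×_; _,_; proj₁; ∃-syntax)
open import Relation.Binary.PropositionalEquality using (_≡_)
open import Relation.Nullary using (¬_)

TVar : Set
TVar = ℕ

PVar : Set
PVar = ℕ

data Tm : Set where
  var : TVar → Tm
  fun : ℕ → List Tm → Tm

data Fm : Set where
  atom : ℕ → List Tm → Fm
  _⇒_  : Fm → Fm → Fm
  all  : TVar → Fm → Fm

infixr 5 _⇒_

data IsAtom : Fm → Set where
  isAtom : ∀ p ts → IsAtom (atom p ts)

arrows : List Fm → Fm → Fm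
arrows []       P = P
arrows (C ∷ Cs) P = C ⇒ arrows Cs P

mutual
  varsT : Tm → List TVar
  varsT (var x)    = x ∷ []
  varsT (fun f ts) = varsTs ts

  varsTs : List Tm → List TVar
  varsTs []       = []
  varsTs (t ∷ ts) = varsT t Data.List.++ varsTs ts

data FreeIn (x : TVar) : Fm → Set where
  atom : ∀ {p ts} → x ∈ varsTs ts → FreeIn x (atom p ts)
  ⇒ˡ   : ∀ {A B} → FreeIn x A → FreeIn x (A ⇒ B)
  ⇒ʳ   : ∀ {A B} → FreeIn x B → FreeIn x (A ⇒ B)
  all  : ∀ {y A} → ¬ x ≡ y → FreeIn x A → FreeIn x (all y A)

data Occurs (x : TVar) : Fm → Set where
  atom  : ∀ {p ts} → x ∈ varsTs ts → Occurs x (atom p ts)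
  ⇒ˡ    : ∀ {A B} → Occurs x A → Occurs x (A ⇒ B)
  ⇒ʳ    : ∀ {A B} → Occurs x B → Occurs x (A ⇒ B)
  bound : ∀ {A} → Occurs x (all x A)
  all   : ∀ {y A} → Occurs x A → Occurs x (all y A)

Ren : Set
Ren = TVar → TVar

mutual
  renT : Ren → Tm → Tm
  renT ρ (var x)    = var (ρ x)
  renT ρ (fun f ts) = fun f (renTs ρ ts)

  renTs : Ren → List Tm → List Tm
  renTs ρ []       = []
  renTs ρ (t ∷ ts) = renT ρ t ∷ renTs ρ ts

bind : Ren → TVar → Ren
bind ρ x y = if y ≡ᵇ x then y else ρ y

renF : Ren → Fm → Fm
renF ρ (atom p ts) = atom p (renTs ρ ts)
renF ρ (A ⇒ B)     = renF ρ A ⇒ renF ρ B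
renF ρ (all x A)   = all x (renF (bind ρ x) A)

restrict : List TVar → (TVar → TVar) → Ren
restrict D f x = if any (x ≡ᵇ_) D then f x else x

Ctx : Set
Ctx = List (PVar × Fm)

dom : Ctx → List PVar
dom = map proj₁

NotFreeInCtx : TVar → Ctx → Set
NotFreeInCtx x Δ = ∀ {β C} → (β , C) ∈ Δ → ¬ FreeIn x C

data PT : Set where
  app  : PVar → List PT → PT
  lamT : TVar → PT → PT
  lamP : PVar → PT → PT

infix 4 _⊢_∶_ _⊢*_∶_

mutual
  data _⊢_∶_ (Δ : Ctx) : PT → Fm → Set where
    L⇒ : ∀ {α As P ts} → (α , arrows As P) ∈ Δ → IsAtom P →
         Δ ⊢* ts ∶ As → Δ ⊢ app α ts ∶ P
    R∀ : ∀ {x t A} → Δ ⊢ t ∶ A → NotFreeInCtx x Δ → Δ ⊢ lamT x t ∶ all x A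
    -- Δ , α : A must again be a context: α not yet declared in Δ
    R⇒ : ∀ {α t A B} → α ∉ dom Δ → ((α , A) ∷ Δ) ⊢ t ∶ B →
         Δ ⊢ lamP α t ∶ (A ⇒ B)

  data _⊢*_∶_ (Δ : Ctx) : List PT → List Fm → Set where
    []  : Δ ⊢* [] ∶ []
    _∷_ : ∀ {t ts A As} → Δ ⊢ t ∶ A → Δ ⊢* ts ∶ As → Δ ⊢* (t ∷ ts) ∶ (A ∷ As)

-- Partial duplication.  Fin 2 indexes the two copies (index 0 ↔ σ₁, 1 ↔ σ₂).
-- D : common domain of σ₁, σ₂; σᵢ = restrict D (f i).
-- cp i γ : the i-th copy γᵢ of the proof variable γ.

σ : List TVar → (Fin 2 → TVar → TVar) → Fin 2 → Ren
σ D f i = restrict D (f i)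

record PartialDup (Σ : Ctx) (A : Fm) (Δ : Ctx) (B : Fm)
                  (D : List TVar) (f : Fin 2 → TVar → TVar)
                  (cp : Fin 2 → PVar → PVar) : Set where
  field
    distinct   : ∀ {i j x y} → x ∈ D → y ∈ D → f i x ≡ f j y → i ≡ j × x ≡ y
    freshA     : ∀ {i x} → x ∈ D → ¬ Occurs (f i x) A
    freshΣ     : ∀ {i x γ C} → x ∈ D → (γ , C) ∈ Σ → ¬ Occurs (f i x) C
    cp-inj     : ∀ {i j γ δ} → cp i γ ≡ cp j δ → i ≡ j × γ ≡ δ
    covers     : ∀ {γ C} → (γ , C) ∈ Σ → ∃[ i ] ((cp i γ , renF (σ D f i) C) ∈ Δ)
    onlyCopies : ∀ {β E} → (β , E) ∈ Δ →
                 ∃[ γ ] ∃[ C ] ∃[ i ] ((γ , C) ∈ Σ × β ≡ cp i γ × E ≡ renF (σ D f i) C)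
    goal       : ∃[ i ] (B ≡ renF (σ D f i) A)

-- The set 𝓕_{Σ ⊢ A}^{Δ ⊢ B}(u), as a relation:  𝓕 s cp Σ A Δ B u t  means
-- t ∈ 𝓕_{Σ ⊢ A}^{Δ ⊢ B}(u) for the renamings s 0 = σ₁, s 1 = σ₂.

module _ (s : Fin 2 → Ren) (cp : Fin 2 → PVar → PVar) where
  mutual
    data 𝓕 : Ctx → Fm → Ctx → Fm → PT → PT → Set where
      F-head : ∀ {Σ A Δ B α Cs us ts} (i : Fin 2) →
               (α , arrows Cs A) ∈ Σ → IsAtom A →
               (cp i α , arrows (map (renF (s i)) Cs) (renF (s i) A)) ∈ Δ →
               renF (s i) A ≡ B →
               𝓕* Σ Δ Cs (map (renF (s i)) Cs) us ts →
               𝓕 Σ A Δ B (app α us) (app (cp i α) ts)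
      F-lamT : ∀ {Σ A₁ Δ B₁ x u t} (i : Fin 2) → B₁ ≡ renF (s i) A₁ →
               𝓕 Σ A₁ Δ B₁ u t →
               𝓕 Σ (all x A₁) Δ (all x B₁) (lamT x u) (lamT x t)
      F-lamP : ∀ {Σ A₁ A₂ Δ B₁ B₂ α u t} (i j : Fin 2) →
               B₁ ≡ renF (s i) A₁ → B₂ ≡ renF (s j) A₂ →
               𝓕 ((α , A₁) ∷ Σ) A₂ ((cp i α , B₁) ∷ Δ) B₂ u t →
               𝓕 Σ (A₁ ⇒ A₂) Δ (B₁ ⇒ B₂) (lamP α u) (lamP (cp i α) t)

    data 𝓕* (Σ : Ctx) (Δ : Ctx) : List Fm → List Fm → List PT → List PT → Set where
      []  : 𝓕* Σ Δ [] [] [] []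
      _∷_ : ∀ {C Cs B Bs u us t ts} → 𝓕 Σ C Δ B u t → 𝓕* Σ Δ Cs Bs us ts →
            𝓕* Σ Δ (C ∷ Cs) (B ∷ Bs) (u ∷ us) (t ∷ ts)

{-# OPTIONS --safe #-}
module Submission where

-- What is carried
-- through the induction is that Δ consists of copies γᵢ : σᵢC of declarations γ : C of
-- Σ, with the copy map injective, and that the renamed-to variables stay fresh for Σ
-- and for the current goal. In the head case the declaration of α in Σ is unique, so
-- the argument formulas read off the typing of u and off the clause of 𝓕 coincide.
-- In the ∀ case the eigenvariable x stays admissible for Δ: a free variable of σᵢC is
-- either free in C, hence not x, or a fresh variable, which does not occur in ∀x A.

open import Defs
open import Data.Fin using (Fin)
open import Data.List using (List; []; _∷_; map; _++_)
open import Data.List.Properties using (map-++)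
open import Data.List.Relation.Unary.All as All using (All; []; _∷_)
open import Data.List.Relation.Unary.All.Properties.Core using (¬Any⇒All¬)
open import Data.List.Relation.Unary.Any as Any using (here; there)
open import Data.List.Relation.Unary.Any.Properties using (any⁻)
open import Data.List.Relation.Unary.Unique.Propositional using (Unique)
open import Data.List.Relation.Unary.AllPairs using (_∷_)
open import Data.List.Membership.Propositional using (_∈_; _∉_)
open import Data.List.Membership.Propositional.Properties using (∈-map⁺; ∈-map⁻)
open import Data.Bool using (true; false; T)
open import Data.Bool.ListAction using (any)
open import Data.Nat using (_≡ᵇ_)
open import Data.Nat.Properties using (≡ᵇ⇒≡; ≡⇒≡ᵇ)
open import Data.Product using (_×_; _,_; ∃-syntax)
open import Data.Sum using (_⊎_; inj₁; inj₂)
open import Data.Empty using (⊥-elim)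
open import Function using (_∘_)
open import Relation.Nullary using (¬_)
open import Relation.Binary.PropositionalEquality
  using (_≡_; _≢_; refl; sym; trans; subst; cong₂; module ≡-Reasoning)

mutual
  varsT-renT : ∀ ρ t → varsT (renT ρ t) ≡ map ρ (varsT t)
  varsT-renT ρ (var x)    = refl
  varsT-renT ρ (fun g ts) = varsTs-renTs ρ ts

  varsTs-renTs : ∀ ρ ts → varsTs (renTs ρ ts) ≡ map ρ (varsTs ts)
  varsTs-renTs ρ []       = refl
  varsTs-renTs ρ (t ∷ ts) = begin
    varsT (renT ρ t) ++ varsTs (renTs ρ ts)
      ≡⟨ cong₂ _++_ (varsT-renT ρ t) (varsTs-renTs ρ ts) ⟩
    map ρ (varsT t) ++ map ρ (varsTs ts)
      ≡⟨ map-++ ρ (varsT t) (varsTs ts) ⟨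
    map ρ (varsTs (t ∷ ts)) ∎
    where open ≡-Reasoning

FreeIn-renF⁻ : ∀ {ρ C x} → FreeIn x (renF ρ C) → ∃[ z ] (FreeIn z C × ρ z ≡ x)
FreeIn-renF⁻ {ρ} {atom p ts} (atom x∈) with ∈-map⁻ ρ (subst (_ ∈_) (varsTs-renTs ρ ts) x∈)
... | z , z∈ , refl = z , atom z∈ , refl
FreeIn-renF⁻ {C = A ⇒ B} (⇒ˡ x-free) with FreeIn-renF⁻ x-free
... | z , z-free , e = z , ⇒ˡ z-free , e
FreeIn-renF⁻ {C = A ⇒ B} (⇒ʳ x-free) with FreeIn-renF⁻ x-free
... | z , z-free , e = z , ⇒ʳ z-free , e
FreeIn-renF⁻ {ρ} {all y A} (all x≢y x-free) with FreeIn-renF⁻ x-free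
... | z , z-free , e with z ≡ᵇ y in z≟y
... | true  = ⊥-elim (x≢y (trans (sym e) (≡ᵇ⇒≡ z y (subst T (sym z≟y) _))))
... | false = z , all (λ z≡y → subst T z≟y (≡⇒≡ᵇ z y z≡y)) z-free , e

renF-isAtom : ∀ {ρ P} → IsAtom P → IsAtom (renF ρ P)
renF-isAtom (isAtom p ts) = isAtom p _

⇒-injective : ∀ {A B C D} → A ⇒ B ≡ C ⇒ D → A ≡ C × B ≡ D
⇒-injective refl = refl , refl

arrows-injective : ∀ {As Bs P Q} → IsAtom P → IsAtom Q →
                   arrows As P ≡ arrows Bs Q → As ≡ Bs × P ≡ Q
arrows-injective {[]}     {[]}     _            _            e = refl , e
arrows-injective {[]}     {_ ∷ _}  (isAtom _ _) _            ()
arrows-injective {_ ∷ _}  {[]}     _            (isAtom _ _) ()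
arrows-injective {_ ∷ As} {_ ∷ Bs} aP           aQ           e
  with ⇒-injective e
... | refl , e′ with arrows-injective {As} {Bs} aP aQ e′
... | refl , refl = refl , refl

restrict-cases : ∀ D g z → (z ∈ D × restrict D g z ≡ g z) ⊎ restrict D g z ≡ z
restrict-cases D g z with any (z ≡ᵇ_) D in z∈?D
... | true  = inj₁ (Any.map (≡ᵇ⇒≡ z _) (any⁻ (z ≡ᵇ_) D (subst T (sym z∈?D) _)) , refl)
... | false = inj₂ refl

declaration-unique : ∀ {Σ : Ctx} {α C C′} → Unique (dom Σ) →
                     (α , C) ∈ Σ → (α , C′) ∈ Σ → C ≡ C′
declaration-unique _         (here refl) (here refl) = refl
declaration-unique (α∉ ∷ _)  (here refl) (there m)   = ⊥-elim (All.lookup α∉ (∈-map⁺ _ m) refl)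
declaration-unique (α∉ ∷ _)  (there m)   (here refl) = ⊥-elim (All.lookup α∉ (∈-map⁺ _ m) refl)
declaration-unique (_ ∷ uΣ) (there m)   (there m′)  = declaration-unique uΣ m m′

Fresh : List TVar → (Fin 2 → TVar → TVar) → Fm → Set
Fresh D f C = All (λ x → ∀ i → ¬ Occurs (f i x) C) D

module _ {D : List TVar} {f : Fin 2 → TVar → TVar} where

  Fresh-⇒⁻ : ∀ {A B} → Fresh D f (A ⇒ B) → Fresh D f A × Fresh D f B
  Fresh-⇒⁻ fresh = All.map (λ h i → h i ∘ ⇒ˡ) fresh , All.map (λ h i → h i ∘ ⇒ʳ) fresh

  Fresh-arrows⁻ : ∀ {Cs P} → Fresh D f (arrows Cs P) → All (Fresh D f) Cs
  Fresh-arrows⁻ {[]}     fresh = []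
  Fresh-arrows⁻ {C ∷ Cs} fresh with Fresh-⇒⁻ {C} fresh
  ... | freshC , freshCs = freshC ∷ Fresh-arrows⁻ freshCs

  Fresh-all⁻ : ∀ {x A} → Fresh D f (all x A) → Fresh D f A
  Fresh-all⁻ = All.map (λ h i → h i ∘ all)

  Fresh-binder : ∀ {x A i z} → Fresh D f (all x A) → z ∈ D → f i z ≢ x
  Fresh-binder {i = i} fresh z∈D refl = All.lookup fresh z∈D i bound

record Duplicate (D : List TVar) (f : Fin 2 → TVar → TVar) (cp : Fin 2 → PVar → PVar)
                 (Σ Δ : Ctx) : Set where
  field
    unique-Σ     : Unique (dom Σ)
    fresh-Σ      : ∀ {γ C} → (γ , C) ∈ Σ → Fresh D f C
    cp-injective : ∀ {i j γ δ} → cp i γ ≡ cp j δ → i ≡ j × γ ≡ δ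
    onlyCopies   : ∀ {β E} → (β , E) ∈ Δ →
                   ∃[ γ ] ∃[ C ] ∃[ i ] ((γ , C) ∈ Σ × β ≡ cp i γ × E ≡ renF (σ D f i) C)

open Duplicate

module _ {D : List TVar} {f : Fin 2 → TVar → TVar} {cp : Fin 2 → PVar → PVar} where

  PartialDup⇒Duplicate : ∀ {Σ A Δ B} → Unique (dom Σ) → PartialDup Σ A Δ B D f cp →
                         Duplicate D f cp Σ Δ
  PartialDup⇒Duplicate uΣ pd = record
    { unique-Σ     = uΣ
    ; fresh-Σ      = λ γ∈Σ → All.tabulate λ x∈D i → PartialDup.freshΣ pd x∈D γ∈Σ
    ; cp-injective = PartialDup.cp-inj pd
    ; onlyCopies   = PartialDup.onlyCopies pd
    }

  copy-∉ : ∀ {Σ Δ α i} → Duplicate D f cp Σ Δ → α ∉ dom Σ → cp i α ∉ dom Δ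
  copy-∉ dup α∉Σ cpα∈Δ with ∈-map⁻ _ cpα∈Δ
  ... | _ , β∈Δ , e with onlyCopies dup β∈Δ
  ... | _ , _ , _ , γ∈Σ , refl , _ with cp-injective dup e
  ... | _ , refl = α∉Σ (∈-map⁺ _ γ∈Σ)

  Duplicate-extend : ∀ {Σ Δ α A} i → Duplicate D f cp Σ Δ → α ∉ dom Σ → Fresh D f A →
                     Duplicate D f cp ((α , A) ∷ Σ) ((cp i α , renF (σ D f i) A) ∷ Δ)
  Duplicate-extend {Σ} {α = α} {A} i dup α∉Σ freshA = record
    { unique-Σ     = ¬Any⇒All¬ (dom Σ) α∉Σ ∷ unique-Σ dup
    ; fresh-Σ      = λ { (here refl) → freshA ; (there γ∈Σ) → fresh-Σ dup γ∈Σ }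
    ; cp-injective = cp-injective dup
    ; onlyCopies   = λ
        { (here refl) → α , A , i , here refl , refl , refl
        ; (there β∈Δ) → let γ , C , j , γ∈Σ , eβ , eE = onlyCopies dup β∈Δ
                         in γ , C , j , there γ∈Σ , eβ , eE }
    }

  NotFreeInCtx-copies : ∀ {Σ Δ x} → Duplicate D f cp Σ Δ →
                        (∀ {i z} → z ∈ D → f i z ≢ x) →
                        NotFreeInCtx x Σ → NotFreeInCtx x Δ
  NotFreeInCtx-copies dup x∉img notFreeΣ β∈Δ x-free with onlyCopies dup β∈Δ
  ... | _ , C , i , γ∈Σ , refl , refl with FreeIn-renF⁻ x-free
  ... | z , z-free , refl with restrict-cases D (f i) z
  ... | inj₁ (z∈D , e) = x∉img z∈D (sym e)
  ... | inj₂ e         = notFreeΣ γ∈Σ (subst (λ y → FreeIn y C) (sym e) z-free)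

  mutual
    𝓕-sound : ∀ {Σ A Δ B u t} → Duplicate D f cp Σ Δ → Fresh D f A →
              Σ ⊢ u ∶ A → 𝓕 (σ D f) cp Σ A Δ B u t → Δ ⊢ t ∶ B
    𝓕-sound dup _ (L⇒ α∈Σ aP ⊢us) (F-head i α∈Σ′ aA cpα∈Δ refl us↦ts)
      with arrows-injective aP aA (declaration-unique (unique-Σ dup) α∈Σ α∈Σ′)
    ... | refl , refl =
      L⇒ cpα∈Δ (renF-isAtom aA) (𝓕*-sound dup (Fresh-arrows⁻ (fresh-Σ dup α∈Σ)) ⊢us us↦ts)
    𝓕-sound dup freshA (R∀ ⊢u notFreeΣ) (F-lamT _ refl u↦t) =
      R∀ (𝓕-sound dup (Fresh-all⁻ freshA) ⊢u u↦t)
         (NotFreeInCtx-copies dup (Fresh-binder freshA) notFreeΣ)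
    𝓕-sound dup freshA (R⇒ α∉Σ ⊢u) (F-lamP i _ refl refl u↦t) with Fresh-⇒⁻ freshA
    ... | freshA₁ , freshA₂ =
      R⇒ (copy-∉ dup α∉Σ) (𝓕-sound (Duplicate-extend i dup α∉Σ freshA₁) freshA₂ ⊢u u↦t)

    𝓕*-sound : ∀ {Σ Δ Cs Bs us ts} → Duplicate D f cp Σ Δ → All (Fresh D f) Cs →
               Σ ⊢* us ∶ Cs → 𝓕* (σ D f) cp Σ Δ Cs Bs us ts → Δ ⊢* ts ∶ Bs
    𝓕*-sound dup []               []          []            = []
    𝓕*-sound dup (freshC ∷ fresh) (⊢u ∷ ⊢us) (u↦t ∷ us↦ts) =
      𝓕-sound dup freshC ⊢u u↦t ∷ 𝓕*-sound dup fresh ⊢us us↦ts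

proposition4 : (Σ : Ctx) (A : Fm) (Δ : Ctx) (B : Fm)
               (D : List TVar) (f : Fin 2 → TVar → TVar) (cp : Fin 2 → PVar → PVar) →
               Unique (dom Σ) → Unique (dom Δ) →
               PartialDup Σ A Δ B D f cp →
               (u t : PT) → Σ ⊢ u ∶ A → 𝓕 (σ D f) cp Σ A Δ B u t → Δ ⊢ t ∶ B
proposition4 Σ A Δ B D f cp uΣ _ pd u t ⊢u u↦t =
  𝓕-sound (PartialDup⇒Duplicate uΣ pd) (All.tabulate λ x∈D i → PartialDup.freshA pd x∈D) ⊢u u↦t
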